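{- (1) Any two finite $2d$-regular graphs have a tight product. (2) If $G_1$ and $G_2$ are both $(2d+1)$-regular and both have a perfect matching, then $G_1$ and $G_2$ have a tight product.
   Context: All graphs are finite, undirected, and may have multiple edges and loops. Degrees count multiple edges with multiplicity, and a loop contributes $2$ to the degree of its vertex; the neighbor set $N_G(v)$ is a multiset. A map $\phi:V(H)\to V(G)$ is a covering map if for every $v\in V(H)$, $\phi$ maps the multiset $N_H(v)$ one-to-one and onto the multiset $N_G(\phi(v))$. A graph $H$ is a tight product of graphs $G_1$ and $G_2$ if $V(H)=V(G_1)\times V(G_2)$ and both coordinate projections $V(H)\to V(G_1)$ and $V(H)\to V(G_2)$ are covering maps. -}

module Defs where

open import Data.Nat using (ℕ; zero; suc; _+_; _*_; _≤_)
open import Data.Nat.Properties using ()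
open import Data.Nat.Base using (_%_)
open import Data.Fin using (Fin; zero; suc; _≟_; remQuot)
open import Data.Bool using (if_then_else_)
open import Data.Product using (Σ; _×_; proj₁; proj₂)
open import Relation.Nullary using (¬_)
open import Relation.Nullary.Decidable using (⌊_⌋)
open import Relation.Binary.PropositionalEquality using (_≡_)

∑ : ∀ {n} → (Fin n → ℕ) → ℕ
∑ {zero}  f = 0
∑ {suc n} f = f zero + ∑ (λ i → f (suc i))

-- A finite multigraph (multiple edges and loops allowed) on vertex set Fin n.
-- adj u v is the multiplicity of v in the neighbour multiset N(u).
-- For u ≢ v it is the number of edges between u and v; for u ≡ v it is
-- twice the number of loops at u (each loop contributes u twice to N(u)
-- and 2 to the degree), hence it is even.
record Multigraph (n : ℕ) : Set where
  field
    adj       : Fin n → Fin n → ℕ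
    adj-sym   : ∀ u v → adj u v ≡ adj v u
    loop-even : ∀ v → adj v v % 2 ≡ 0
open Multigraph public

degree : ∀ {n} → Multigraph n → Fin n → ℕ
degree G v = ∑ (adj G v)

Regular : ∀ {n} → Multigraph n → ℕ → Set
Regular G k = ∀ v → degree G v ≡ k

PerfectMatching : ∀ {n} → Multigraph n → Set
PerfectMatching {n} G =
  Σ (Fin n → Fin n) λ μ →
    (∀ v → μ (μ v) ≡ v) × (∀ v → ¬ (μ v ≡ v)) × (∀ v → 1 ≤ adj G v (μ v))

-- φ : V(H) → V(G) maps the multiset N_H(v) one-to-one and onto N_G(φ v):
-- for every w ∈ V(G), the multiplicity of w in the image multiset φ(N_H(v))
-- equals the multiplicity of w in N_G(φ v).
IsCovering : ∀ {m n} → Multigraph m → Multigraph n → (Fin m → Fin n) → Set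
IsCovering H G φ =
  ∀ v w → ∑ (λ u → if ⌊ φ u ≟ w ⌋ then adj H v u else 0) ≡ adj G (φ v) w

-- H is a tight product of G₁ and G₂: V(H) = V(G₁) × V(G₂), identified with
-- Fin (n₁ * n₂) via the standard bijection remQuot, and both coordinate
-- projections are covering maps.
IsTightProduct : ∀ {n₁ n₂} → Multigraph n₁ → Multigraph n₂ → Multigraph (n₁ * n₂) → Set
IsTightProduct {n₁} {n₂} G₁ G₂ H =
  IsCovering H G₁ (λ x → proj₁ (remQuot {n₁} n₂ x)) ×
  IsCovering H G₂ (λ x → proj₂ (remQuot {n₁} n₂ x))

HaveTightProduct : ∀ {n₁ n₂} → Multigraph n₁ → Multigraph n₂ → Set
HaveTightProduct {n₁} {n₂} G₁ G₂ = Σ (Multigraph (n₁ * n₂)) (IsTightProduct G₁ G₂)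

-- Both cases rest on one kind of factorisation. By Petersen's theorem a 2d-regular graph is the union of
-- d permutations σᵢ, each joining u to σᵢ u and σᵢ⁻¹ u; a (2d+1)-regular graph with a perfect matching μ is
-- such a union plus μ. Given factorisations (σᵢ, μ) of G₁ and (τᵢ, ν) of G₂ with the same shape, joining
-- (u, v) to (σᵢ u, τᵢ v), (σᵢ⁻¹ u, τᵢ⁻¹ v) and (μ u, ν v) gives a tight product: each projection maps the
-- neighbours of (u, v) exactly onto the neighbours of u, resp. v.
-- Petersen's theorem follows by orienting the graph so that every vertex has in- and out-degree d (splitting
-- off pairs of edges at a vertex) and decomposing the resulting d-regular bipartite graph into d perfect
-- matchings, each found by Alon's halving argument.

module Submission where

open import Defs
open import Data.Nat using (ℕ; zero; suc; _+_; _*_; _∸_; _^_; _/_; _%_; _≤_; _<_; z≤n; s≤s; _≤?_; _<?_)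
open import Data.Nat.Properties hiding (_≟_)
open import Data.Nat.DivMod using (m≡m%n+[m/n]*n; m%n<n)
open import Data.Nat.Divisibility
  using (_∣_; divides; quotient; _∣0; ∣m∣n⇒∣m+n; ∣m+n∣m⇒∣n; ∣1⇒≡1; m%n≡0⇒n∣m; n∣m⇒m%n≡0)
open import Data.Nat.Tactic.RingSolver using (solve-∀)
open import Algebra.Properties.Semiring.Sum +-*-semiring as Sum using (sum)
open import Algebra.Properties.CommutativeSemigroup +-commutativeSemigroup using (xy∙z≈xz∙y)
open import Data.Fin using (Fin; zero; suc; _≟_; remQuot; combine; splitAt; _↑ˡ_; _↑ʳ_)
open import Data.Fin.Properties using (remQuot-combine; splitAt-↑ˡ; splitAt-↑ʳ; any?)
open import Data.Fin.Permutation using (Permutation′; permutation; _⟨$⟩ʳ_; _⟨$⟩ˡ_; inverseˡ; inverseʳ)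
open import Data.Bool using (if_then_else_)
open import Data.Product using (Σ; _×_; _,_; proj₁; proj₂; ∃)
open import Data.Sum using (_⊎_; inj₁; inj₂)
open import Function using (_∘_)
open import Relation.Nullary using (¬_; yes; no)
open import Relation.Nullary.Decidable using (⌊_⌋; ¬?; _×-dec_; toSum)
open import Relation.Nullary.Negation using (contradiction)
open import Relation.Binary.PropositionalEquality

private
  variable
    m n n₁ n₂ d e : ℕ

∑≡sum : (f : Fin n → ℕ) → ∑ f ≡ sum f
∑≡sum {zero}  f = refl
∑≡sum {suc n} f = cong (f zero +_) (∑≡sum (λ i → f (suc i)))

∑-cong : {f g : Fin n → ℕ} → (∀ i → f i ≡ g i) → ∑ f ≡ ∑ g
∑-cong {f = f} {g} f≗g = trans (∑≡sum f) (trans (Sum.sum-cong-≗ {x = f} {y = g} f≗g) (sym (∑≡sum g)))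

∑-distrib-+ : (f g : Fin n → ℕ) → ∑ (λ i → f i + g i) ≡ ∑ f + ∑ g
∑-distrib-+ f g = begin
  ∑ (λ i → f i + g i)  ≡⟨ ∑≡sum (λ i → f i + g i) ⟩
  sum (λ i → f i + g i) ≡⟨ Sum.∑-distrib-+ f g ⟩
  sum f + sum g         ≡⟨ cong₂ _+_ (∑≡sum f) (∑≡sum g) ⟨
  ∑ f + ∑ g             ∎
  where open ≡-Reasoning

∑-comm : (f : Fin m → Fin n → ℕ) → ∑ (λ i → ∑ (f i)) ≡ ∑ (λ j → ∑ (λ i → f i j))
∑-comm f = begin
  ∑ (λ i → ∑ (f i))               ≡⟨ trans (∑-cong (λ i → ∑≡sum (f i))) (∑≡sum (λ i → sum (f i))) ⟩
  sum (λ i → sum (f i))           ≡⟨ Sum.∑-comm f ⟩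
  sum (λ j → sum (λ i → f i j))
    ≡⟨ trans (∑-cong (λ j → ∑≡sum (λ i → f i j))) (∑≡sum (λ j → sum (λ i → f i j))) ⟨
  ∑ (λ j → ∑ (λ i → f i j))       ∎
  where open ≡-Reasoning

∑-zero : ∑ {n} (λ _ → 0) ≡ 0
∑-zero {n} = trans (∑≡sum {n} (λ _ → 0)) (Sum.sum-replicate-zero n)

*-distribˡ-∑ : ∀ c (f : Fin n → ℕ) → ∑ (λ i → c * f i) ≡ c * ∑ f
*-distribˡ-∑ c f = trans (∑≡sum (λ i → c * f i)) (trans (sym (Sum.*-distribˡ-sum c f)) (cong (c *_) (sym (∑≡sum f))))

*-distribʳ-∑ : ∀ c (f : Fin n → ℕ) → ∑ (λ i → f i * c) ≡ ∑ f * c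
*-distribʳ-∑ c f = trans (∑≡sum (λ i → f i * c)) (trans (sym (Sum.*-distribʳ-sum c f)) (cong (_* c) (sym (∑≡sum f))))

∑-mono-≤ : {f g : Fin n → ℕ} → (∀ i → f i ≤ g i) → ∑ f ≤ ∑ g
∑-mono-≤ {zero}  f≤g = z≤n
∑-mono-≤ {suc n} f≤g = +-mono-≤ (f≤g zero) (∑-mono-≤ (λ i → f≤g (suc i)))

∑-∸ : (f g : Fin n → ℕ) → (∀ i → g i ≤ f i) → ∑ (λ i → f i ∸ g i) ≡ ∑ f ∸ ∑ g
∑-∸ f g g≤f = begin
  ∑ (λ i → f i ∸ g i)                    ≡⟨ m+n∸n≡m _ (∑ g) ⟨
  ∑ (λ i → f i ∸ g i) + ∑ g ∸ ∑ g        ≡⟨ cong (_∸ ∑ g) (∑-distrib-+ (λ i → f i ∸ g i) g) ⟨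
  ∑ (λ i → f i ∸ g i + g i) ∸ ∑ g        ≡⟨ cong (_∸ ∑ g) (∑-cong (λ i → m∸n+n≡m (g≤f i))) ⟩
  ∑ f ∸ ∑ g                              ∎
  where open ≡-Reasoning

≤-∑ : (f : Fin n → ℕ) (a : Fin n) → f a ≤ ∑ f
≤-∑ f zero    = m≤m+n _ _
≤-∑ f (suc a) = ≤-trans (≤-∑ (λ i → f (suc i)) a) (m≤n+m _ (f zero))

∑≡0⇒≡0 : (f : Fin n → ℕ) → ∑ f ≡ 0 → ∀ a → f a ≡ 0
∑≡0⇒≡0 f ∑f≡0 a = n≤0⇒n≡0 (subst (f a ≤_) ∑f≡0 (≤-∑ f a))

∑-positive : (f : Fin n → ℕ) → 1 ≤ ∑ f → ∃ λ a → 1 ≤ f a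
∑-positive {suc n} f 1≤∑f with f zero in eq
... | suc _ = zero , subst (1 ≤_) (sym eq) (s≤s z≤n)
... | zero  with ∑-positive (λ i → f (suc i)) 1≤∑f
...   | a , 1≤fa = suc a , 1≤fa

∑-const : ∀ c → ∑ {n} (λ _ → c) ≡ n * c
∑-const {zero}  c = refl
∑-const {suc n} c = cong (c +_) (∑-const {n} c)

∣-∑ : ∀ {d} (f : Fin n → ℕ) → (∀ i → d ∣ f i) → d ∣ ∑ f
∣-∑ {zero}  f d∣f = _ ∣0
∣-∑ {suc n} f d∣f = ∣m∣n⇒∣m+n (d∣f zero) (∣-∑ (λ i → f (suc i)) (λ i → d∣f (suc i)))

∑-↑ : ∀ m (f : Fin (m + n) → ℕ) → ∑ f ≡ ∑ (λ i → f (i ↑ˡ n)) + ∑ (λ j → f (m ↑ʳ j))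
∑-↑ zero    f = refl
∑-↑ (suc m) f = trans (cong (f zero +_) (∑-↑ m (λ i → f (suc i)))) (sym (+-assoc (f zero) _ _))

∑-combine : ∀ m n (f : Fin (m * n) → ℕ) → ∑ f ≡ ∑ (λ a → ∑ (λ b → f (combine {m} {n} a b)))
∑-combine zero    n f = refl
∑-combine (suc m) n f = trans (∑-↑ n f) (cong (∑ (λ b → f (b ↑ˡ (m * n))) +_) (∑-combine m n (λ j → f (n ↑ʳ j))))

∑-remQuot : ∀ m n (g : Fin m → Fin n → ℕ) →
            ∑ (λ x → g (proj₁ (remQuot {m} n x)) (proj₂ (remQuot {m} n x))) ≡ ∑ (λ a → ∑ (g a))
∑-remQuot m n g = trans (∑-combine m n _)
  (∑-cong (λ a → ∑-cong (λ b → cong (λ (p : Fin m × Fin n) → g (proj₁ p) (proj₂ p)) (remQuot-combine a b))))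

δ : Fin n → Fin n → ℕ
δ a b = if ⌊ a ≟ b ⌋ then 1 else 0

if-δ : (a b : Fin n) (x : ℕ) → (if ⌊ a ≟ b ⌋ then x else 0) ≡ δ a b * x
if-δ a b x with a ≟ b
... | yes _ = sym (+-identityʳ x)
... | no  _ = refl

δ-≡ : {a b : Fin n} → a ≡ b → δ a b ≡ 1
δ-≡ {a = a} {b} a≡b with a ≟ b
... | yes _   = refl
... | no  a≢b = contradiction a≡b a≢b

δ-refl : (a : Fin n) → δ a a ≡ 1
δ-refl a = δ-≡ refl

δ-≢ : {a b : Fin n} → ¬ a ≡ b → δ a b ≡ 0
δ-≢ {a = a} {b} a≢b with a ≟ b
... | yes a≡b = contradiction a≡b a≢b
... | no  _   = refl

δ-suc : (a b : Fin n) → δ (suc a) (suc b) ≡ δ a b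
δ-suc a b with a ≟ b
... | yes _ = refl
... | no  _ = refl

δ-sym : (a b : Fin n) → δ a b ≡ δ b a
δ-sym a b with a ≟ b
... | yes a≡b = sym (δ-≡ (sym a≡b))
... | no  a≢b = sym (δ-≢ (λ b≡a → a≢b (sym b≡a)))

∑-δ-* : (a : Fin n) (g : Fin n → ℕ) → ∑ (λ b → δ a b * g b) ≡ g a
∑-δ-* {suc n} zero    g = trans (cong (g zero + 0 +_) (∑-zero {n})) (trans (+-identityʳ _) (+-identityʳ _))
∑-δ-* {suc n} (suc a) g =
  trans (∑-cong (λ b → cong (_* g (suc b)) (δ-suc a b))) (∑-δ-* a (λ b → g (suc b)))

∑-δ-*′ : (a : Fin n) (g : Fin n → ℕ) → ∑ (λ b → δ b a * g b) ≡ g a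
∑-δ-*′ a g = trans (∑-cong (λ b → cong (_* g b) (δ-sym b a))) (∑-δ-* a g)

∑-δ : (a : Fin n) → ∑ (δ a) ≡ 1
∑-δ a = trans (∑-cong (λ b → sym (*-identityʳ (δ a b)))) (∑-δ-* a (λ _ → 1))

∑-δ′ : (b : Fin n) → ∑ (λ a → δ a b) ≡ 1
∑-δ′ b = trans (∑-cong (λ a → δ-sym a b)) (∑-δ b)

δ-inverse : (f g : Fin n → Fin n) → (∀ u → f (g u) ≡ u) → (∀ u → g (f u) ≡ u) →
            ∀ u w → δ (f u) w ≡ δ (g w) u
δ-inverse f g fg gf u w with f u ≟ w | g w ≟ u
... | yes _    | yes _    = refl
... | no  _    | no  _    = refl
... | yes fu≡w | no  gw≢u = contradiction (trans (cong g (sym fu≡w)) (gf u)) gw≢u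
... | no  fu≢w | yes gw≡u = contradiction (trans (cong f (sym gw≡u)) (fg w)) fu≢w

Matrix : ℕ → Set
Matrix n = Fin n → Fin n → ℕ

Symmetric : Matrix n → Set
Symmetric A = ∀ u w → A u w ≡ A w u

total : Matrix n → ℕ
total A = ∑ (λ u → ∑ (A u))

entry≤total : (A : Matrix n) (u w : Fin n) → A u w ≤ total A
entry≤total A u w = ≤-trans (≤-∑ (A u) w) (≤-∑ (λ v → ∑ (A v)) u)

2∣n+n : ∀ m → 2 ∣ m + m
2∣n+n m = divides m (trans (cong (m +_) (sym (+-identityʳ m))) (*-comm 2 m))

record IsEulerianOrientation (A O : Matrix n) : Set where
  field
    splits   : ∀ u w → O u w + O w u ≡ A u w
    balanced : ∀ u → ∑ (O u) ≡ ∑ (λ w → O w u)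

EulerianOrientation : Matrix n → Set
EulerianOrientation {n} A = Σ (Matrix n) (IsEulerianOrientation A)

arc : Fin n → Fin n → Matrix n
arc a b u w = δ a u * δ b w

edge : Fin n → Fin n → Matrix n
edge a b u w = arc a b u w + arc a b w u

∑-arc-out : (a b u : Fin n) → ∑ (arc a b u) ≡ δ a u
∑-arc-out a b u = trans (*-distribˡ-∑ (δ a u) (δ b)) (trans (cong (δ a u *_) (∑-δ b)) (*-identityʳ _))

∑-arc-in : (a b u : Fin n) → ∑ (λ w → arc a b w u) ≡ δ b u
∑-arc-in a b u = trans (*-distribʳ-∑ (δ b u) (δ a)) (trans (cong (_* δ b u) (∑-δ a)) (*-identityˡ _))

∑-edge : (a b u : Fin n) → ∑ (edge a b u) ≡ δ a u + δ b u
∑-edge a b u = trans (∑-distrib-+ (arc a b u) (λ w → arc a b w u)) (cong₂ _+_ (∑-arc-out a b u) (∑-arc-in a b u))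

edge-sym : (a b u w : Fin n) → edge a b u w ≡ edge a b w u
edge-sym a b u w = +-comm (arc a b u w) (arc a b w u)

edge-comm : (a b u w : Fin n) → edge a b u w ≡ edge b a u w
edge-comm a b u w = trans (+-comm (arc a b u w) _) (cong₂ _+_ (*-comm (δ a w) (δ b u)) (*-comm (δ a u) (δ b w)))

diagonalOrientation : (A : Matrix n) → (∀ u w → ¬ u ≡ w → A u w ≡ 0) → (∀ u → 2 ∣ A u u) →
                      EulerianOrientation A
diagonalOrientation A offDiagonal loops = O , record { splits = splits ; balanced = balanced }
  where
  loopCount : Fin _ → ℕ
  loopCount u = quotient (loops u)
  O : Matrix _
  O u w = δ u w * loopCount u
  splits : ∀ u w → O u w + O w u ≡ A u w
  splits u w with toSum (u ≟ w)
  ... | inj₁ refl = begin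
    δ u u * loopCount u + δ u u * loopCount u ≡⟨ cong (λ k → k * loopCount u + k * loopCount u) (δ-refl u) ⟩
    loopCount u + 0 + (loopCount u + 0)       ≡⟨ cong (_+ (loopCount u + 0)) (+-identityʳ (loopCount u)) ⟩
    loopCount u + (loopCount u + 0)           ≡⟨ *-comm 2 (loopCount u) ⟩
    loopCount u * 2                      ≡⟨ _∣_.equality (loops u) ⟨
    A u u                           ∎
    where open ≡-Reasoning
  ... | inj₂ u≢w = trans (cong₂ (λ j k → j * loopCount u + k * loopCount w) (δ-≢ u≢w) (δ-≢ (u≢w ∘ sym)))
                         (sym (offDiagonal u w u≢w))
  balanced : ∀ u → ∑ (O u) ≡ ∑ (λ w → O w u)
  balanced u = begin
    ∑ (λ w → δ u w * loopCount u) ≡⟨ *-distribʳ-∑ (loopCount u) (δ u) ⟩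
    ∑ (δ u) * loopCount u         ≡⟨ cong (_* loopCount u) (∑-δ u) ⟩
    1 * loopCount u               ≡⟨ *-identityˡ (loopCount u) ⟩
    loopCount u                   ≡⟨ ∑-δ-* u loopCount ⟨
    ∑ (λ w → δ u w * loopCount w) ≡⟨ ∑-cong (λ w → cong (_* loopCount w) (δ-sym u w)) ⟩
    ∑ (λ w → δ w u * loopCount w) ∎
    where open ≡-Reasoning

arc≤ : (O : Matrix n) {a b : Fin n} → 1 ≤ O a b → ∀ u w → arc a b u w ≤ O u w
arc≤ O {a} {b} 1≤Oab u w with toSum (a ≟ u) | toSum (b ≟ w)
... | inj₁ refl | inj₁ refl = subst (_≤ O a b) (sym (cong₂ _*_ (δ-refl a) (δ-refl b))) 1≤Oab
... | inj₁ _    | inj₂ b≢w  = subst (_≤ O u w) (sym (trans (cong (δ a u *_) (δ-≢ b≢w)) (*-zeroʳ (δ a u)))) z≤n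
... | inj₂ a≢u  | _         = subst (_≤ O u w) (sym (cong (_* δ b w) (δ-≢ a≢u))) z≤n

private
  interchange₈ : ∀ p q α α′ β β′ γ γ′ →
                 (p + α + β) + (q + α′ + β′) + (γ + γ′) ≡ (p + γ) + (q + γ′) + ((α + α′) + (β + β′))
  interchange₈ = solve-∀

-- An arc a → b of an orientation of A′ is replaced by the path a → x → b.
reroute : {A A′ : Matrix n} {x a b : Fin n} →
          (∀ u w → A′ u w + (edge a x u w + edge x b u w) ≡ A u w + edge a b u w) →
          (O′ : Matrix n) → IsEulerianOrientation A′ O′ → 1 ≤ O′ a b → EulerianOrientation A
reroute {n} {A} {A′} {x} {a} {b} exchange O′ isO′ 1≤O′ab = O , record { splits = splits ; balanced = balanced }
  where
  open IsEulerianOrientation isO′ renaming (splits to splits′; balanced to balanced′)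
  P O : Matrix n
  P u w = O′ u w ∸ arc a b u w
  O u w = P u w + arc a x u w + arc x b u w
  P+arc : ∀ u w → P u w + arc a b u w ≡ O′ u w
  P+arc u w = m∸n+n≡m (arc≤ O′ 1≤O′ab u w)
  splits : ∀ u w → O u w + O w u ≡ A u w
  splits u w = +-cancelʳ-≡ (edge a b u w) _ _ (begin
    O u w + O w u + edge a b u w
      ≡⟨ interchange₈ (P u w) (P w u) (arc a x u w) (arc a x w u) (arc x b u w) (arc x b w u) (arc a b u w) (arc a b w u) ⟩
    (P u w + arc a b u w) + (P w u + arc a b w u) + (edge a x u w + edge x b u w)
      ≡⟨ cong (_+ (edge a x u w + edge x b u w)) (trans (cong₂ _+_ (P+arc u w) (P+arc w u)) (splits′ u w)) ⟩
    A′ u w + (edge a x u w + edge x b u w)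
      ≡⟨ exchange u w ⟩
    A u w + edge a b u w ∎)
    where open ≡-Reasoning
  out-P : ∀ u → ∑ (P u) + δ a u ≡ ∑ (O′ u)
  out-P u = trans (cong (∑ (P u) +_) (sym (∑-arc-out a b u))) (trans (sym (∑-distrib-+ (P u) (arc a b u))) (∑-cong (P+arc u)))
  in-P : ∀ u → ∑ (λ w → P w u) + δ b u ≡ ∑ (λ w → O′ w u)
  in-P u = trans (cong (∑ (λ w → P w u) +_) (sym (∑-arc-in a b u)))
                 (trans (sym (∑-distrib-+ (λ w → P w u) (λ w → arc a b w u))) (∑-cong (λ w → P+arc w u)))
  balanced : ∀ u → ∑ (O u) ≡ ∑ (λ w → O w u)
  balanced u = begin
    ∑ (O u)                                     ≡⟨ ∑-distrib-+ (λ w → P u w + arc a x u w) (arc x b u) ⟩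
    ∑ (λ w → P u w + arc a x u w) + ∑ (arc x b u) ≡⟨ cong₂ _+_ (∑-distrib-+ (P u) (arc a x u)) (∑-arc-out x b u) ⟩
    ∑ (P u) + ∑ (arc a x u) + δ x u             ≡⟨ cong (λ k → ∑ (P u) + k + δ x u) (∑-arc-out a x u) ⟩
    ∑ (P u) + δ a u + δ x u
      ≡⟨ cong (_+ δ x u) (trans (out-P u) (trans (balanced′ u) (sym (in-P u)))) ⟩
    ∑ (λ w → P w u) + δ b u + δ x u             ≡⟨ xy∙z≈xz∙y (∑ (λ w → P w u)) (δ b u) (δ x u) ⟩
    ∑ (λ w → P w u) + δ x u + δ b u             ≡⟨ cong (λ k → ∑ (λ w → P w u) + k + δ b u) (∑-arc-in a x u) ⟨
    ∑ (λ w → P w u) + ∑ (λ w → arc a x w u) + δ b u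
      ≡⟨ cong₂ _+_ (∑-distrib-+ (λ w → P w u) (λ w → arc a x w u)) (∑-arc-in x b u) ⟨
    ∑ (λ w → P w u + arc a x w u) + ∑ (λ w → arc x b w u)
      ≡⟨ ∑-distrib-+ (λ w → P w u + arc a x w u) (λ w → arc x b w u) ⟨
    ∑ (λ w → O w u)                             ∎
    where open ≡-Reasoning

secondNeighbour : (A : Matrix n) {x y : Fin n} → 2 ∣ A x x → 2 ∣ ∑ (A x) → ¬ x ≡ y → 1 ≤ A x y →
                  ∃ λ z → ¬ z ≡ x × δ y z < A x z
secondNeighbour A {x} {y} loop even-row x≢y 1≤Axy with any? (λ z → ¬? (z ≟ x) ×-dec (δ y z <? A x z))
... | yes found = found
... | no none   = contradiction (∣1⇒≡1 (∣m+n∣m⇒∣n (subst (2 ∣_) row-sum even-row) loop)) λ ()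
  where
  onlyY : ∀ w → ¬ w ≡ x → A x w ≤ δ y w
  onlyY w w≢x = ≮⇒≥ (λ δyw<Axw → none (w , w≢x , δyw<Axw))
  entry : ∀ w → A x w ≡ δ x w * A x x + δ y w
  entry w with toSum (x ≟ w) | toSum (y ≟ w)
  ... | inj₁ refl | _ =
    sym (trans (cong₂ _+_ (trans (cong (_* A x x) (δ-refl x)) (*-identityˡ _)) (δ-≢ (x≢y ∘ sym))) (+-identityʳ _))
  ... | inj₂ x≢w | inj₁ refl =
    trans (≤-antisym (onlyY y (x≢y ∘ sym)) (subst (_≤ A x y) (sym (δ-refl y)) 1≤Axy))
          (cong (_+ δ y y) (sym (cong (_* A x x) (δ-≢ x≢w))))
  ... | inj₂ x≢w | inj₂ y≢w =
    trans (n≤0⇒n≡0 (subst (A x w ≤_) (δ-≢ y≢w) (onlyY w (x≢w ∘ sym))))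
          (cong₂ _+_ (sym (cong (_* A x x) (δ-≢ x≢w))) (sym (δ-≢ y≢w)))
  row-sum : ∑ (A x) ≡ A x x + 1
  row-sum = begin
    ∑ (A x)                                  ≡⟨ ∑-cong entry ⟩
    ∑ (λ w → δ x w * A x x + δ y w)          ≡⟨ ∑-distrib-+ (λ w → δ x w * A x x) (δ y) ⟩
    ∑ (λ w → δ x w * A x x) + ∑ (δ y)        ≡⟨ cong₂ _+_ (*-distribʳ-∑ (A x x) (δ x)) (∑-δ y) ⟩
    ∑ (δ x) * A x x + 1                      ≡⟨ cong (λ k → k * A x x + 1) (∑-δ x) ⟩
    1 * A x x + 1                            ≡⟨ cong (_+ 1) (*-identityˡ (A x x)) ⟩
    A x x + 1                                ∎
    where open ≡-Reasoning

private
  cancel-ends : ∀ s x y z → (x + x) + s + (y + z) ≡ s + ((y + x) + (x + z))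
  cancel-ends = solve-∀

-- The edges x–y and x–z are replaced by one edge y–z.
module SplittingOff (A : Matrix n) (A-sym : Symmetric A) {x y z : Fin n}
                    (x≢y : ¬ x ≡ y) (z≢x : ¬ z ≡ x) (1≤Axy : 1 ≤ A x y) (δyz<Axz : δ y z < A x z) where

  A′ : Matrix n
  A′ u w = (A u w + edge y z u w) ∸ (edge y x u w + edge x z u w)

  removed-at-x : ∀ w → edge y x x w + edge x z x w ≡ δ y w + δ z w
  removed-at-x w rewrite δ-≢ (x≢y ∘ sym) | δ-refl x | δ-≢ z≢x =
    cong₂ _+_ (*-identityʳ (δ y w)) (trans (cong₂ _+_ (+-identityʳ (δ z w)) (*-zeroʳ (δ x w))) (+-identityʳ (δ z w)))

  removed-away : ∀ {u w} → ¬ x ≡ u → ¬ x ≡ w → edge y x u w + edge x z u w ≡ 0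
  removed-away {u} {w} x≢u x≢w rewrite δ-≢ x≢u | δ-≢ x≢w =
    trans (+-identityʳ _) (cong₂ _+_ (*-zeroʳ (δ y u)) (*-zeroʳ (δ y w)))

  twoEdges : ∀ w → δ y w + δ z w ≤ A x w
  twoEdges w with toSum (y ≟ w) | toSum (z ≟ w)
  ... | inj₁ y≡w | inj₁ z≡w = subst₂ _≤_ (sym (cong₂ _+_ (δ-≡ y≡w) (δ-≡ z≡w))) (cong (A x) z≡w)
                                (subst (λ k → suc k ≤ A x z) (δ-≡ (trans y≡w (sym z≡w))) δyz<Axz)
  ... | inj₁ y≡w | inj₂ z≢w = subst₂ _≤_ (sym (cong₂ _+_ (δ-≡ y≡w) (δ-≢ z≢w))) (cong (A x) y≡w) 1≤Axy
  ... | inj₂ y≢w | inj₁ z≡w = subst₂ _≤_ (sym (cong₂ _+_ (δ-≢ y≢w) (δ-≡ z≡w))) (cong (A x) z≡w)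
                                (≤-trans (s≤s z≤n) δyz<Axz)
  ... | inj₂ y≢w | inj₂ z≢w = subst (_≤ A x w) (sym (cong₂ _+_ (δ-≢ y≢w) (δ-≢ z≢w))) z≤n

  removed≤-at-x : ∀ w → edge y x x w + edge x z x w ≤ A x w + edge y z x w
  removed≤-at-x w = ≤-trans (≤-reflexive (removed-at-x w)) (≤-trans (twoEdges w) (m≤m+n _ _))

  removed≤ : ∀ u w → edge y x u w + edge x z u w ≤ A u w + edge y z u w
  removed≤ u w with toSum (x ≟ u) | toSum (x ≟ w)
  ... | inj₁ refl | _         = removed≤-at-x w
  ... | inj₂ _    | inj₁ refl = subst₂ _≤_ (cong₂ _+_ (edge-sym y x x u) (edge-sym x z x u))
                                           (cong₂ _+_ (A-sym x u) (edge-sym y z x u)) (removed≤-at-x u)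
  ... | inj₂ x≢u  | inj₂ x≢w  = subst (_≤ A u w + edge y z u w) (sym (removed-away x≢u x≢w)) z≤n

  exchange : ∀ u w → A′ u w + (edge y x u w + edge x z u w) ≡ A u w + edge y z u w
  exchange u w = m∸n+n≡m (removed≤ u w)

  A′-sym : Symmetric A′
  A′-sym u w = cong₂ _∸_ (cong₂ _+_ (A-sym u w) (edge-sym y z u w)) (cong₂ _+_ (edge-sym y x u w) (edge-sym x z u w))

  A′-loops : (∀ u → 2 ∣ A u u) → ∀ u → 2 ∣ A′ u u
  A′-loops loops u = ∣m+n∣m⇒∣n (subst (2 ∣_) (sym (trans (+-comm _ (A′ u u)) (exchange u u)))
                                  (∣m∣n⇒∣m+n (loops u) (2∣n+n (arc y z u u))))
                               (∣m∣n⇒∣m+n (2∣n+n (arc y x u u)) (2∣n+n (arc x z u u)))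

  A′-row : ∀ u → (δ x u + δ x u) + ∑ (A′ u) ≡ ∑ (A u)
  A′-row u = +-cancelʳ-≡ (δ y u + δ z u) _ _ (begin
    (δ x u + δ x u) + ∑ (A′ u) + (δ y u + δ z u)
      ≡⟨ cancel-ends (∑ (A′ u)) (δ x u) (δ y u) (δ z u) ⟩
    ∑ (A′ u) + ((δ y u + δ x u) + (δ x u + δ z u))
      ≡⟨ cong (∑ (A′ u) +_) (cong₂ _+_ (∑-edge y x u) (∑-edge x z u)) ⟨
    ∑ (A′ u) + (∑ (edge y x u) + ∑ (edge x z u))
      ≡⟨ cong (∑ (A′ u) +_) (∑-distrib-+ (edge y x u) (edge x z u)) ⟨
    ∑ (A′ u) + ∑ (λ w → edge y x u w + edge x z u w)
      ≡⟨ ∑-distrib-+ (A′ u) (λ w → edge y x u w + edge x z u w) ⟨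
    ∑ (λ w → A′ u w + (edge y x u w + edge x z u w))
      ≡⟨ ∑-cong (exchange u) ⟩
    ∑ (λ w → A u w + edge y z u w)
      ≡⟨ ∑-distrib-+ (A u) (edge y z u) ⟩
    ∑ (A u) + ∑ (edge y z u)
      ≡⟨ cong (∑ (A u) +_) (∑-edge y z u) ⟩
    ∑ (A u) + (δ y u + δ z u) ∎)
    where open ≡-Reasoning

  A′-rows : (∀ u → 2 ∣ ∑ (A u)) → ∀ u → 2 ∣ ∑ (A′ u)
  A′-rows rows u = ∣m+n∣m⇒∣n (subst (2 ∣_) (sym (A′-row u)) (rows u)) (2∣n+n (δ x u))

  A′-total : 2 + total A′ ≡ total A
  A′-total = begin
    2 + total A′                                       ≡⟨ cong₂ _+_ (cong₂ _+_ (∑-δ x) (∑-δ x)) refl ⟨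
    (∑ (δ x) + ∑ (δ x)) + total A′                     ≡⟨ cong (_+ total A′) (∑-distrib-+ (δ x) (δ x)) ⟨
    ∑ (λ u → δ x u + δ x u) + total A′                 ≡⟨ ∑-distrib-+ (λ u → δ x u + δ x u) (λ u → ∑ (A′ u)) ⟨
    ∑ (λ u → (δ x u + δ x u) + ∑ (A′ u))               ≡⟨ ∑-cong A′-row ⟩
    total A                                            ∎
    where open ≡-Reasoning

  1≤A′yz : 1 ≤ A′ y z
  1≤A′yz = subst (1 ≤_) (sym A′yz) (≤-trans 1≤edge (m≤n+m _ (A y z)))
    where
    A′yz : A′ y z ≡ A y z + edge y z y z
    A′yz = cong (A y z + edge y z y z ∸_) (removed-away x≢y (z≢x ∘ sym))
    1≤edge : 1 ≤ edge y z y z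
    1≤edge = ≤-trans (≤-reflexive (sym (cong₂ _*_ (δ-refl y) (δ-refl z)))) (m≤m+n _ _)

  lift : EulerianOrientation A′ → EulerianOrientation A
  lift (O′ , isO′) with 1 ≤? O′ y z
  ... | yes 1≤O′yz = reroute exchange O′ isO′ 1≤O′yz
  ... | no  1≰O′yz = reroute exchange′ O′ isO′ 1≤O′zy
    where
    open IsEulerianOrientation isO′
    1≤O′zy : 1 ≤ O′ z y
    1≤O′zy = subst (1 ≤_) (trans (sym (splits y z)) (cong (_+ O′ z y) (n<1⇒n≡0 (≰⇒> 1≰O′yz)))) 1≤A′yz
    exchange′ : ∀ u w → A′ u w + (edge z x u w + edge x y u w) ≡ A u w + edge z y u w
    exchange′ u w = begin
      A′ u w + (edge z x u w + edge x y u w) ≡⟨ cong (A′ u w +_) (cong₂ _+_ (edge-comm z x u w) (edge-comm x y u w)) ⟩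
      A′ u w + (edge x z u w + edge y x u w) ≡⟨ cong (A′ u w +_) (+-comm (edge x z u w) _) ⟩
      A′ u w + (edge y x u w + edge x z u w) ≡⟨ exchange u w ⟩
      A u w + edge y z u w                   ≡⟨ cong (A u w +_) (edge-comm y z u w) ⟩
      A u w + edge z y u w                   ∎
      where open ≡-Reasoning

eulerianOrientation : (A : Matrix n) → Symmetric A → (∀ u → 2 ∣ A u u) → (∀ u → 2 ∣ ∑ (A u)) →
                      EulerianOrientation A
eulerianOrientation A = byTotal (total A) A ≤-refl
  where
  byTotal : ∀ N (A : Matrix _) → total A ≤ N → Symmetric A → (∀ u → 2 ∣ A u u) → (∀ u → 2 ∣ ∑ (A u)) →
            EulerianOrientation A
  byTotal N A bound A-sym loops rows with any? (λ x → any? (λ y → ¬? (x ≟ y) ×-dec (1 ≤? A x y)))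
  ... | no none = diagonalOrientation A (λ u w u≢w → n<1⇒n≡0 (≰⇒> (λ 1≤Auw → none (u , w , u≢w , 1≤Auw)))) loops
  byTotal zero A bound _ _ _ | yes (x , y , _ , 1≤Axy) =
    contradiction (≤-trans 1≤Axy (≤-trans (entry≤total A x y) bound)) λ ()
  byTotal (suc N) A bound A-sym loops rows | yes (x , y , x≢y , 1≤Axy)
    with secondNeighbour A (loops x) (rows x) x≢y 1≤Axy
  ... | z , z≢x , δyz<Axz = lift (byTotal N A′ total-A′≤N A′-sym (A′-loops loops) (A′-rows rows))
    where
    open SplittingOff A A-sym x≢y z≢x 1≤Axy δyz<Axz
    total-A′≤N : total A′ ≤ N
    total-A′≤N = <⇒≤ (≤-pred (subst (_≤ suc N) (sym A′-total) bound))

BiRegular : ℕ → Matrix n → Set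
BiRegular k B = (∀ a → ∑ (B a) ≡ k) × (∀ b → ∑ (λ a → B a b) ≡ k)

m≡n⇒m+n≡2*o⇒m≡o : ∀ {m n o} → m ≡ n → m + n ≡ 2 * o → m ≡ o
m≡n⇒m+n≡2*o⇒m≡o {m} refl m+m≡2o = *-cancelˡ-≡ m _ 2 (trans (cong (m +_) (+-identityʳ m)) m+m≡2o)

record Halving (B : Matrix n) (m : ℕ) : Set where
  field
    left right      : Matrix n
    splits          : ∀ a b → left a b + right a b ≡ B a b
    left-biRegular  : BiRegular m left
    right-biRegular : BiRegular m right

bipartite : Matrix n → Fin n ⊎ Fin n → Fin n ⊎ Fin n → ℕ
bipartite B (inj₁ a) (inj₂ b) = B a b
bipartite B (inj₂ b) (inj₁ a) = B a b
bipartite B (inj₁ _) (inj₁ _) = 0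
bipartite B (inj₂ _) (inj₂ _) = 0

bipartite-sym : (B : Matrix n) → ∀ s t → bipartite B s t ≡ bipartite B t s
bipartite-sym B (inj₁ _) (inj₁ _) = refl
bipartite-sym B (inj₁ _) (inj₂ _) = refl
bipartite-sym B (inj₂ _) (inj₁ _) = refl
bipartite-sym B (inj₂ _) (inj₂ _) = refl

bipartite-loop : (B : Matrix n) → ∀ s → bipartite B s s ≡ 0
bipartite-loop B (inj₁ _) = refl
bipartite-loop B (inj₂ _) = refl

∑-splitAt : (g : Fin n ⊎ Fin n → ℕ) → ∑ (λ j → g (splitAt n j)) ≡ ∑ (λ a → g (inj₁ a)) + ∑ (λ b → g (inj₂ b))
∑-splitAt {n} g = trans (∑-↑ n (λ j → g (splitAt n j)))
  (cong₂ _+_ (∑-cong (λ a → cong g (splitAt-↑ˡ n a n))) (∑-cong (λ b → cong g (splitAt-↑ʳ n n b))))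

bipartite-row : (B : Matrix n) → BiRegular m B → ∀ s → ∑ (λ j → bipartite B s (splitAt n j)) ≡ m
bipartite-row {n} {m} B (rows , cols) s = trans (∑-splitAt (bipartite B s)) (sides s)
  where
  sides : ∀ s → ∑ (λ a → bipartite B s (inj₁ a)) + ∑ (λ b → bipartite B s (inj₂ b)) ≡ m
  sides (inj₁ a) = trans (cong (_+ ∑ (B a)) (∑-zero {n})) (rows a)
  sides (inj₂ b) = trans (cong (∑ (λ a → B a b) +_) (∑-zero {n})) (trans (+-identityʳ _) (cols b))

∑-↑ʳ-only : (f : Fin (n + n) → ℕ) → (∀ a → f (a ↑ˡ n) ≡ 0) → ∑ f ≡ ∑ (λ b → f (n ↑ʳ b))
∑-↑ʳ-only {n} f left≡0 = trans (∑-↑ n f) (cong (_+ ∑ (λ b → f (n ↑ʳ b))) (trans (∑-cong left≡0) (∑-zero {n})))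

∑-↑ˡ-only : (f : Fin (n + n) → ℕ) → (∀ b → f (n ↑ʳ b) ≡ 0) → ∑ f ≡ ∑ (λ a → f (a ↑ˡ n))
∑-↑ˡ-only {n} f right≡0 = trans (∑-↑ n f)
  (trans (cong (∑ (λ a → f (a ↑ˡ n)) +_) (trans (∑-cong right≡0) (∑-zero {n}))) (+-identityʳ _))

-- An Eulerian orientation of the bipartite graph of B: arcs left → right form one half, right → left the other.
halve : (B : Matrix n) → BiRegular (2 * m) B → Halving B m
halve {n} {m} B (rows , cols) = record
  { left = X ; right = Y ; splits = X+Y
  ; left-biRegular  = X-row , X-col
  ; right-biRegular = (λ a → trans (sym (out≡in-left a)) (X-row a)) , (λ b → trans (sym (in≡out-right b)) (X-col b)) }
  where
  D : Matrix (n + n)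
  D i j = bipartite B (splitAt n i) (splitAt n j)
  orientation : EulerianOrientation D
  orientation = eulerianOrientation D (λ i j → bipartite-sym B (splitAt n i) (splitAt n j))
    (λ i → subst (2 ∣_) (sym (bipartite-loop B (splitAt n i))) (2∣n+n 0))
    (λ i → subst (2 ∣_) (sym (bipartite-row B (rows , cols) (splitAt n i))) (divides m (*-comm 2 m)))
  O = proj₁ orientation
  open IsEulerianOrientation (proj₂ orientation)
  L R : Fin n → Fin (n + n)
  L a = a ↑ˡ n
  R b = n ↑ʳ b
  X Y : Matrix n
  X a b = O (L a) (R b)
  Y a b = O (R b) (L a)
  O≡0 : ∀ {i j} → D i j ≡ 0 → O i j ≡ 0
  O≡0 {i} {j} Dij≡0 = n≤0⇒n≡0 (subst (O i j ≤_) (trans (splits i j) Dij≡0) (m≤m+n _ _))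
  O-LL : ∀ a c → O (L a) (L c) ≡ 0
  O-LL a c = O≡0 (cong₂ (bipartite B) (splitAt-↑ˡ n a n) (splitAt-↑ˡ n c n))
  O-RR : ∀ b c → O (R b) (R c) ≡ 0
  O-RR b c = O≡0 (cong₂ (bipartite B) (splitAt-↑ʳ n n b) (splitAt-↑ʳ n n c))
  X+Y : ∀ a b → X a b + Y a b ≡ B a b
  X+Y a b = trans (splits (L a) (R b)) (cong₂ (bipartite B) (splitAt-↑ˡ n a n) (splitAt-↑ʳ n n b))
  out≡in-left : ∀ a → ∑ (X a) ≡ ∑ (Y a)
  out≡in-left a = trans (sym (∑-↑ʳ-only (O (L a)) (O-LL a)))
                        (trans (balanced (L a)) (∑-↑ʳ-only (λ j → O j (L a)) (λ c → O-LL c a)))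
  in≡out-right : ∀ b → ∑ (λ a → X a b) ≡ ∑ (λ a → Y a b)
  in≡out-right b = trans (sym (∑-↑ˡ-only (λ j → O j (R b)) (λ c → O-RR c b)))
                         (trans (sym (balanced (R b))) (∑-↑ˡ-only (O (R b)) (O-RR b)))
  X-row : ∀ a → ∑ (X a) ≡ m
  X-row a = m≡n⇒m+n≡2*o⇒m≡o (out≡in-left a)
    (trans (sym (∑-distrib-+ (X a) (Y a))) (trans (∑-cong (X+Y a)) (rows a)))
  X-col : ∀ b → ∑ (λ a → X a b) ≡ m
  X-col b = m≡n⇒m+n≡2*o⇒m≡o (in≡out-right b)
    (trans (sym (∑-distrib-+ (λ a → X a b) (λ a → Y a b))) (trans (∑-cong (λ a → X+Y a b)) (cols b)))

weight : Matrix n → Matrix n → ℕ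
weight W C = ∑ (λ a → ∑ (λ b → W a b * C a b))

weight-+ : (W X Y C : Matrix n) → (∀ a b → X a b + Y a b ≡ C a b) → weight W X + weight W Y ≡ weight W C
weight-+ W X Y C X+Y = begin
  weight W X + weight W Y
    ≡⟨ ∑-distrib-+ (λ a → ∑ (λ b → W a b * X a b)) (λ a → ∑ (λ b → W a b * Y a b)) ⟨
  ∑ (λ a → ∑ (λ b → W a b * X a b) + ∑ (λ b → W a b * Y a b))
    ≡⟨ ∑-cong (λ a → ∑-distrib-+ (λ b → W a b * X a b) (λ b → W a b * Y a b)) ⟨
  ∑ (λ a → ∑ (λ b → W a b * X a b + W a b * Y a b))
    ≡⟨ ∑-cong (λ a → ∑-cong (λ b → trans (sym (*-distribˡ-+ (W a b) _ _)) (cong (W a b *_) (X+Y a b)))) ⟩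
  weight W C ∎
  where open ≡-Reasoning

m≤n⇒m+n≡o⇒2*m≤o : ∀ {m n o} → m ≤ n → m + n ≡ o → 2 * m ≤ o
m≤n⇒m+n≡o⇒2*m≤o {m} {o = o} m≤n m+n≡o =
  subst (_≤ o) (cong (m +_) (sym (+-identityʳ m))) (subst (m + m ≤_) m+n≡o (+-monoʳ-≤ m m≤n))

lighterHalf : (W C : Matrix n) → Halving C m → Σ (Matrix n) λ X → BiRegular m X × 2 * weight W X ≤ weight W C
lighterHalf W C record { left = X ; right = Y ; splits = X+Y ; left-biRegular = X-reg ; right-biRegular = Y-reg }
  with weight W X ≤? weight W Y
... | yes wX≤wY = X , X-reg , m≤n⇒m+n≡o⇒2*m≤o wX≤wY (weight-+ W X Y C X+Y)
... | no  wX≰wY = Y , Y-reg , m≤n⇒m+n≡o⇒2*m≤o (<⇒≤ (≰⇒> wX≰wY))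
                                                (trans (+-comm (weight W Y) _) (weight-+ W X Y C X+Y))

descent : ∀ s (W C : Matrix n) → BiRegular (2 ^ s) C → Σ (Matrix n) λ P → BiRegular 1 P × weight W P * 2 ^ s ≤ weight W C
descent zero    W C reg = C , reg , ≤-reflexive (*-identityʳ _)
descent (suc s) W C reg with lighterHalf W C (halve C reg)
... | X , X-reg , 2wX≤wC with descent s W X X-reg
...   | P , P-reg , wP≤wX = P , P-reg , (begin
  weight W P * (2 * 2 ^ s)   ≡⟨ *-comm (weight W P) (2 * 2 ^ s) ⟩
  2 * 2 ^ s * weight W P     ≡⟨ *-assoc 2 (2 ^ s) (weight W P) ⟩
  2 * (2 ^ s * weight W P)   ≡⟨ cong (2 *_) (*-comm (2 ^ s) (weight W P)) ⟩
  2 * (weight W P * 2 ^ s)   ≤⟨ *-monoʳ-≤ 2 wP≤wX ⟩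
  2 * weight W X             ≤⟨ 2wX≤wC ⟩
  weight W C                 ∎)
  where open ≤-Reasoning

≤-∑₂ : (f : Fin n → ℕ) {a b : Fin n} → ¬ a ≡ b → f a + f b ≤ ∑ f
≤-∑₂ f {zero}  {zero}  a≢b = contradiction refl a≢b
≤-∑₂ f {zero}  {suc b} _   = +-monoʳ-≤ (f zero) (≤-∑ (λ i → f (suc i)) b)
≤-∑₂ f {suc a} {zero}  _   = subst (_≤ ∑ f) (+-comm (f zero) _) (+-monoʳ-≤ (f zero) (≤-∑ (λ i → f (suc i)) a))
≤-∑₂ f {suc a} {suc b} a≢b = ≤-trans (≤-∑₂ (λ i → f (suc i)) (a≢b ∘ cong suc)) (m≤n+m _ (f zero))

∑≡1-unique : (f : Fin n → ℕ) → ∑ f ≡ 1 → ∀ {a b} → 1 ≤ f a → 1 ≤ f b → a ≡ b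
∑≡1-unique f ∑f≡1 {a} {b} 1≤fa 1≤fb with a ≟ b
... | yes a≡b = a≡b
... | no  a≢b = contradiction (≤-trans (+-mono-≤ 1≤fa 1≤fb) (subst (f a + f b ≤_) ∑f≡1 (≤-∑₂ f a≢b))) 1+n≰n

permutationIn : (P : Matrix n) → BiRegular 1 P → Σ (Permutation′ n) λ π → ∀ a → 1 ≤ P a (π ⟨$⟩ʳ a)
permutationIn P (rows , cols) = permutation σ τ στ τσ , λ a → proj₂ (inRow a)
  where
  inRow : ∀ a → ∃ λ b → 1 ≤ P a b
  inRow a = ∑-positive (P a) (≤-reflexive (sym (rows a)))
  inCol : ∀ b → ∃ λ a → 1 ≤ P a b
  inCol b = ∑-positive (λ a → P a b) (≤-reflexive (sym (cols b)))
  σ τ : Fin _ → Fin _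
  σ a = proj₁ (inRow a)
  τ b = proj₁ (inCol b)
  στ : ∀ b → σ (τ b) ≡ b
  στ b = ∑≡1-unique (P (τ b)) (rows (τ b)) (proj₂ (inRow (τ b))) (proj₂ (inCol b))
  τσ : ∀ a → τ (σ a) ≡ a
  τσ a = ∑≡1-unique (λ c → P c (σ a)) (cols (σ a)) (proj₂ (inCol (σ a))) (proj₂ (inRow a))

n<2^n : ∀ k → k < 2 ^ k
n<2^n zero    = s≤s z≤n
n<2^n (suc k) = subst₂ _≤_ (+-comm (suc k) 1) (cong (2 ^ k +_) (sym (+-identityʳ (2 ^ k))))
                       (+-mono-≤ (n<2^n k) (m^n>0 2 k))

offSupport : Matrix n → Matrix n
offSupport O a b = 1 ∸ O a b

weight-offSupport-≤ : (O : Matrix n) (α β : ℕ) → weight (offSupport O) (λ a b → α * O a b + β * δ a b) ≤ n * β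
weight-offSupport-≤ {n} O α β = begin
  weight (offSupport O) (λ a b → α * O a b + β * δ a b)
    ≤⟨ ∑-mono-≤ (λ a → ∑-mono-≤ (λ b → off≤ (O a b) (β * δ a b))) ⟩
  ∑ (λ (a : Fin n) → ∑ (λ b → β * δ a b))
    ≡⟨ ∑-cong {n} (λ a → trans (*-distribˡ-∑ β (δ a)) (cong (β *_) (∑-δ a))) ⟩
  ∑ (λ (_ : Fin n) → β * 1)                 ≡⟨ ∑-const {n} (β * 1) ⟩
  n * (β * 1)                               ≡⟨ cong (n *_) (*-identityʳ β) ⟩
  n * β                                     ∎
  where
  open ≤-Reasoning
  off≤ : ∀ k c → (1 ∸ k) * (α * k + c) ≤ c
  off≤ zero    c = ≤-reflexive (trans (+-identityʳ _) (cong (_+ c) (*-zeroʳ α)))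
  off≤ (suc k) c = subst (_≤ c) (sym (cong (_* (α * suc k + c)) (0∸n≡0 k))) z≤n

weight-offSupport≡0 : (O P : Matrix n) → weight (offSupport O) P ≡ 0 → ∀ a b → 1 ≤ P a b → 1 ≤ O a b
weight-offSupport≡0 O P weight≡0 a b 1≤Pab
  with m*n≡0⇒m≡0∨n≡0 (1 ∸ O a b)
         (∑≡0⇒≡0 _ (∑≡0⇒≡0 (λ c → ∑ (λ b → (1 ∸ O c b) * P c b)) weight≡0 a) b)
... | inj₁ 1∸O≡0 = m∸n≡0⇒m≤n 1∸O≡0
... | inj₂ P≡0   = contradiction (subst (1 ≤_) P≡0 1≤Pab) λ ()

-- Alon's argument: α O + β I has line sums 2 ^ t; halving it t times, keeping the half with less mass
-- off the support of O, leaves a permutation matrix whose mass off the support is below 1, hence 0.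
perfectMatching : ∀ {d} (O : Matrix n) → BiRegular (suc d) O →
                  Σ (Permutation′ n) λ π → ∀ a → 1 ≤ O a (π ⟨$⟩ʳ a)
perfectMatching {n} {d} O (rows , cols) = π , 1≤O
  where
  t α β : ℕ
  t = n * suc d
  α = 2 ^ t / suc d
  β = 2 ^ t % suc d
  αD+β : α * suc d + β ≡ 2 ^ t
  αD+β = trans (+-comm (α * suc d) β) (sym (m≡m%n+[m/n]*n (2 ^ t) (suc d)))
  C : Matrix n
  C a b = α * O a b + β * δ a b
  C-line : ∀ (f g : Fin n → ℕ) → ∑ f ≡ suc d → ∑ g ≡ 1 → ∑ (λ i → α * f i + β * g i) ≡ 2 ^ t
  C-line f g ∑f ∑g = begin
    ∑ (λ i → α * f i + β * g i)           ≡⟨ ∑-distrib-+ (λ i → α * f i) (λ i → β * g i) ⟩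
    ∑ (λ i → α * f i) + ∑ (λ i → β * g i) ≡⟨ cong₂ _+_ (*-distribˡ-∑ α f) (*-distribˡ-∑ β g) ⟩
    α * ∑ f + β * ∑ g                     ≡⟨ cong₂ (λ x y → α * x + β * y) ∑f ∑g ⟩
    α * suc d + β * 1                     ≡⟨ cong (α * suc d +_) (*-identityʳ β) ⟩
    α * suc d + β                         ≡⟨ αD+β ⟩
    2 ^ t                                 ∎
    where open ≡-Reasoning
  C-biRegular : BiRegular (2 ^ t) C
  C-biRegular = (λ a → C-line (O a) (δ a) (rows a) (∑-δ a))
              , (λ b → C-line (λ a → O a b) (λ a → δ a b) (cols b) (∑-δ′ b))
  weight-C : weight (offSupport O) C < 2 ^ t
  weight-C = ≤-<-trans (weight-offSupport-≤ O α β) (≤-<-trans (*-monoʳ-≤ n (<⇒≤ (m%n<n (2 ^ t) (suc d)))) (n<2^n t))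
  reduced = descent t (offSupport O) C C-biRegular
  P = proj₁ reduced
  weight-P : weight (offSupport O) P ≡ 0
  weight-P = n<1⇒n≡0 (*-cancelʳ-< (2 ^ t) (weight (offSupport O) P) 1
               (≤-<-trans (proj₂ (proj₂ reduced)) (subst (weight (offSupport O) C <_) (sym (*-identityˡ (2 ^ t))) weight-C)))
  matched = permutationIn P (proj₁ (proj₂ reduced))
  π = proj₁ matched
  1≤O : ∀ a → 1 ≤ O a (π ⟨$⟩ʳ a)
  1≤O a = weight-offSupport≡0 O P weight-P a (π ⟨$⟩ʳ a) (proj₂ matched a)

δ-permutation : (π : Permutation′ n) (u w : Fin n) → δ (π ⟨$⟩ʳ u) w ≡ δ (π ⟨$⟩ˡ w) u
δ-permutation π = δ-inverse (π ⟨$⟩ʳ_) (π ⟨$⟩ˡ_) (λ _ → inverseʳ π) (λ _ → inverseˡ π)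

permutationDecomposition : ∀ d (O : Matrix n) → BiRegular d O →
                           Σ (Fin d → Permutation′ n) λ σ → ∀ u w → O u w ≡ ∑ (λ i → δ (σ i ⟨$⟩ʳ u) w)
permutationDecomposition zero    O (rows , _) = (λ ()) , λ u w → ∑≡0⇒≡0 (O u) (rows u) w
permutationDecomposition {n} (suc d) O (rows , cols) = σ , O≡
  where
  matching = perfectMatching O (rows , cols)
  π = proj₁ matching
  P O′ : Matrix n
  P u w = δ (π ⟨$⟩ʳ u) w
  O′ u w = O u w ∸ P u w
  P≤O : ∀ u w → P u w ≤ O u w
  P≤O u w with toSum (π ⟨$⟩ʳ u ≟ w)
  ... | inj₁ refl = subst (_≤ O u (π ⟨$⟩ʳ u)) (sym (δ-refl (π ⟨$⟩ʳ u))) (proj₂ matching u)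
  ... | inj₂ πu≢w = subst (_≤ O u w) (sym (δ-≢ πu≢w)) z≤n
  O′-biRegular : BiRegular d O′
  O′-biRegular = (λ u → trans (∑-∸ (O u) (P u) (P≤O u)) (cong₂ _∸_ (rows u) (∑-δ (π ⟨$⟩ʳ u))))
               , (λ w → trans (∑-∸ (λ u → O u w) (λ u → P u w) (λ u → P≤O u w))
                              (cong₂ _∸_ (cols w) (trans (∑-cong (λ u → δ-permutation π u w)) (∑-δ (π ⟨$⟩ˡ w)))))
  rest = permutationDecomposition d O′ O′-biRegular
  σ : Fin (suc d) → Permutation′ n
  σ zero    = π
  σ (suc i) = proj₁ rest i
  O≡ : ∀ u w → O u w ≡ P u w + ∑ (λ i → δ (proj₁ rest i ⟨$⟩ʳ u) w)
  O≡ u w = trans (sym (m∸n+n≡m (P≤O u w))) (trans (+-comm (O′ u w) (P u w)) (cong (P u w +_) (proj₂ rest u w)))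

-- A is the adjacency matrix of the union of d permutations, each taken in both directions,
-- and e perfect matchings (fixed-point-free involutions).
record Factorisation (A : Matrix n) (d e : ℕ) : Set where
  field
    σ              : Fin d → Permutation′ n
    μ              : Fin e → Fin n → Fin n
    μ-involutive   : ∀ j u → μ j (μ j u) ≡ u
    μ-fixpointFree : ∀ j u → ¬ μ j u ≡ u
    adjacency      : ∀ u w → A u w ≡ ∑ (λ i → δ (σ i ⟨$⟩ʳ u) w + δ (σ i ⟨$⟩ˡ u) w)
                                   + ∑ (λ j → δ (μ j u) w)

twoFactorisation : ∀ d (A : Matrix n) → Symmetric A → (∀ u → 2 ∣ A u u) → (∀ u → ∑ (A u) ≡ 2 * d) →
                   Factorisation A d 0
twoFactorisation d A A-sym loops rows = record
  { σ = σ ; μ = λ () ; μ-involutive = λ () ; μ-fixpointFree = λ () ; adjacency = adjacency }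
  where
  orientation = eulerianOrientation A A-sym loops (λ u → subst (2 ∣_) (sym (rows u)) (divides d (*-comm 2 d)))
  O = proj₁ orientation
  open IsEulerianOrientation (proj₂ orientation)
  out≡d : ∀ u → ∑ (O u) ≡ d
  out≡d u = m≡n⇒m+n≡2*o⇒m≡o (balanced u)
                             (trans (sym (∑-distrib-+ (O u) (λ w → O w u))) (trans (∑-cong (splits u)) (rows u)))
  decomposition = permutationDecomposition d O (out≡d , λ u → trans (sym (balanced u)) (out≡d u))
  σ = proj₁ decomposition
  adjacency : ∀ u w → A u w ≡ ∑ (λ i → δ (σ i ⟨$⟩ʳ u) w + δ (σ i ⟨$⟩ˡ u) w) + 0
  adjacency u w = begin
    A u w                                       ≡⟨ splits u w ⟨
    O u w + O w u                               ≡⟨ cong₂ _+_ (proj₂ decomposition u w) (proj₂ decomposition w u) ⟩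
    ∑ (forward u w) + ∑ (forward w u)           ≡⟨ ∑-distrib-+ (forward u w) (forward w u) ⟨
    ∑ (λ i → forward u w i + forward w u i)     ≡⟨ ∑-cong (λ i → cong (forward u w i +_) (δ-permutation (σ i) w u)) ⟩
    ∑ (λ i → forward u w i + δ (σ i ⟨$⟩ˡ u) w)     ≡⟨ +-identityʳ _ ⟨
    ∑ (λ i → forward u w i + δ (σ i ⟨$⟩ˡ u) w) + 0 ∎
    where
    open ≡-Reasoning
    forward : Fin _ → Fin _ → Fin d → ℕ
    forward u w i = δ (σ i ⟨$⟩ʳ u) w

addMatching : ∀ {d e} {A A′ : Matrix n} (μ : Fin n → Fin n) → (∀ u → μ (μ u) ≡ u) → (∀ u → ¬ μ u ≡ u) →
              (∀ u w → A u w ≡ A′ u w + δ (μ u) w) → Factorisation A′ d e → Factorisation A d (suc e)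
addMatching {A = A} {A′} μ μ-inv μ-free A≡ F = record
  { σ = σ ; μ = μs ; μ-involutive = μs-involutive ; μ-fixpointFree = μs-fixpointFree ; adjacency = adjacency }
  where
  module F = Factorisation F
  open F using (σ)
  μs : Fin _ → Fin _ → Fin _
  μs zero    = μ
  μs (suc j) = F.μ j
  μs-involutive : ∀ j u → μs j (μs j u) ≡ u
  μs-involutive zero    = μ-inv
  μs-involutive (suc j) = F.μ-involutive j
  μs-fixpointFree : ∀ j u → ¬ μs j u ≡ u
  μs-fixpointFree zero    = μ-free
  μs-fixpointFree (suc j) = F.μ-fixpointFree j
  adjacency : ∀ u w → A u w ≡ ∑ (λ i → δ (σ i ⟨$⟩ʳ u) w + δ (σ i ⟨$⟩ˡ u) w) + ∑ (λ j → δ (μs j u) w)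
  adjacency u w = begin
    A u w                            ≡⟨ A≡ u w ⟩
    A′ u w + δ (μ u) w               ≡⟨ cong (_+ δ (μ u) w) (F.adjacency u w) ⟩
    cycles + matchings + δ (μ u) w   ≡⟨ +-assoc cycles matchings (δ (μ u) w) ⟩
    cycles + (matchings + δ (μ u) w) ≡⟨ cong (cycles +_) (+-comm matchings (δ (μ u) w)) ⟩
    cycles + (δ (μ u) w + matchings) ∎
    where
    open ≡-Reasoning
    cycles    = ∑ (λ i → δ (σ i ⟨$⟩ʳ u) w + δ (σ i ⟨$⟩ˡ u) w)
    matchings = ∑ (λ j → δ (F.μ j u) w)

loops-even : (G : Multigraph n) → ∀ u → 2 ∣ adj G u u
loops-even G u = m%n≡0⇒n∣m (adj G u u) 2 (loop-even G u)

evenFactorisation : ∀ d (G : Multigraph n) → Regular G (2 * d) → Factorisation (adj G) d 0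
evenFactorisation d G = twoFactorisation d (adj G) (adj-sym G) (loops-even G)

oddFactorisation : ∀ d (G : Multigraph n) → Regular G (2 * d + 1) → PerfectMatching G → Factorisation (adj G) d 1
oddFactorisation {n} d G regular (μ , μ-inv , μ-free , 1≤adj) =
  addMatching μ μ-inv μ-free (λ u w → sym (m∸n+n≡m (matched≤adj u w)))
              (twoFactorisation d A′ A′-sym A′-loops A′-rows)
  where
  A′ : Matrix n
  A′ u w = adj G u w ∸ δ (μ u) w
  matched≤adj : ∀ u w → δ (μ u) w ≤ adj G u w
  matched≤adj u w with toSum (μ u ≟ w)
  ... | inj₁ refl  = subst (_≤ adj G u (μ u)) (sym (δ-refl (μ u))) (1≤adj u)
  ... | inj₂ μu≢w  = subst (_≤ adj G u w) (sym (δ-≢ μu≢w)) z≤n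
  A′-sym : Symmetric A′
  A′-sym u w = cong₂ _∸_ (adj-sym G u w) (δ-inverse μ μ μ-inv μ-inv u w)
  A′-loops : ∀ u → 2 ∣ A′ u u
  A′-loops u = subst (2 ∣_) (sym (cong (adj G u u ∸_) (δ-≢ (μ-free u)))) (loops-even G u)
  A′-rows : ∀ u → ∑ (A′ u) ≡ 2 * d
  A′-rows u = trans (∑-∸ (adj G u) (δ (μ u)) (matched≤adj u))
                    (trans (cong₂ _∸_ (regular u) (∑-δ (μ u))) (m+n∸n≡m (2 * d) 1))

Kernel : ℕ → ℕ → Set
Kernel n₁ n₂ = Fin n₁ → Fin n₂ → Fin n₁ → Fin n₂ → ℕ

module _ {n₁ n₂ : ℕ} where

  coord₁ : Fin (n₁ * n₂) → Fin n₁
  coord₁ x = proj₁ (remQuot {n₁} n₂ x)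

  coord₂ : Fin (n₁ * n₂) → Fin n₂
  coord₂ x = proj₂ (remQuot {n₁} n₂ x)

  productGraph : (K : Kernel n₁ n₂) → (∀ u v u′ v′ → K u v u′ v′ ≡ K u′ v′ u v) → (∀ u v → 2 ∣ K u v u v) →
                 Multigraph (n₁ * n₂)
  productGraph K K-sym K-loops = record
    { adj       = λ x y → K (coord₁ x) (coord₂ x) (coord₁ y) (coord₂ y)
    ; adj-sym   = λ x y → K-sym (coord₁ x) (coord₂ x) (coord₁ y) (coord₂ y)
    ; loop-even = λ x → n∣m⇒m%n≡0 _ 2 (K-loops (coord₁ x) (coord₂ x)) }

  module _ (K : Kernel n₁ n₂) (K-sym : ∀ u v u′ v′ → K u v u′ v′ ≡ K u′ v′ u v) (K-loops : ∀ u v → 2 ∣ K u v u v) where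

    covering₁ : (G₁ : Multigraph n₁) → (∀ u v a → ∑ (K u v a) ≡ adj G₁ u a) →
                IsCovering (productGraph K K-sym K-loops) G₁ coord₁
    covering₁ G₁ marginal x w = begin
      ∑ (λ y → if ⌊ coord₁ y ≟ w ⌋ then K u v (coord₁ y) (coord₂ y) else 0)
        ≡⟨ ∑-cong (λ y → if-δ (coord₁ y) w _) ⟩
      ∑ (λ y → δ (coord₁ y) w * K u v (coord₁ y) (coord₂ y))
        ≡⟨ ∑-remQuot n₁ n₂ (λ a b → δ a w * K u v a b) ⟩
      ∑ (λ a → ∑ (λ b → δ a w * K u v a b)) ≡⟨ ∑-cong (λ a → *-distribˡ-∑ (δ a w) (K u v a)) ⟩
      ∑ (λ a → δ a w * ∑ (K u v a))         ≡⟨ ∑-δ-*′ w (λ a → ∑ (K u v a)) ⟩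
      ∑ (K u v w)                           ≡⟨ marginal u v w ⟩
      adj G₁ u w                            ∎
      where
      open ≡-Reasoning
      u = coord₁ x
      v = coord₂ x

    covering₂ : (G₂ : Multigraph n₂) → (∀ u v b → ∑ (λ a → K u v a b) ≡ adj G₂ v b) →
                IsCovering (productGraph K K-sym K-loops) G₂ coord₂
    covering₂ G₂ marginal x w = begin
      ∑ (λ y → if ⌊ coord₂ y ≟ w ⌋ then K u v (coord₁ y) (coord₂ y) else 0)
        ≡⟨ ∑-cong (λ y → if-δ (coord₂ y) w _) ⟩
      ∑ (λ y → δ (coord₂ y) w * K u v (coord₁ y) (coord₂ y))
        ≡⟨ ∑-remQuot n₁ n₂ (λ a b → δ b w * K u v a b) ⟩
      ∑ (λ a → ∑ (λ b → δ b w * K u v a b)) ≡⟨ ∑-cong (λ a → ∑-δ-*′ w (K u v a)) ⟩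
      ∑ (λ a → K u v a w)                   ≡⟨ marginal u v w ⟩
      adj G₂ v w                            ∎
      where
      open ≡-Reasoning
      u = coord₁ x
      v = coord₂ x

link : (Fin n₁ → Fin n₁) → (Fin n₂ → Fin n₂) → Kernel n₁ n₂
link f g u v u′ v′ = δ (f u) u′ * δ (g v) v′

∑-link₂ : (f : Fin n₁ → Fin n₁) (g : Fin n₂ → Fin n₂) → ∀ u v a → ∑ (link f g u v a) ≡ δ (f u) a
∑-link₂ f g u v a = trans (*-distribˡ-∑ (δ (f u) a) (δ (g v))) (trans (cong (δ (f u) a *_) (∑-δ (g v))) (*-identityʳ _))

∑-link₁ : (f : Fin n₁ → Fin n₁) (g : Fin n₂ → Fin n₂) → ∀ u v b → ∑ (λ a → link f g u v a b) ≡ δ (g v) b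
∑-link₁ f g u v b = trans (*-distribʳ-∑ (δ (g v) b) (δ (f u))) (trans (cong (_* δ (g v) b) (∑-δ (f u))) (*-identityˡ _))

link-inverse : (f f′ : Fin n₁ → Fin n₁) (g g′ : Fin n₂ → Fin n₂) →
               (∀ x → f (f′ x) ≡ x) → (∀ x → f′ (f x) ≡ x) → (∀ y → g (g′ y) ≡ y) → (∀ y → g′ (g y) ≡ y) →
               ∀ u v u′ v′ → link f g u v u′ v′ ≡ link f′ g′ u′ v′ u v
link-inverse f f′ g g′ ff′ f′f gg′ g′g u v u′ v′ =
  cong₂ _*_ (δ-inverse f f′ ff′ f′f u u′) (δ-inverse g g′ gg′ g′g v v′)

∑-distrib-∑+∑ : (F : Fin d → Fin m → ℕ) (H : Fin e → Fin m → ℕ) →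
                ∑ (λ b → ∑ (λ i → F i b) + ∑ (λ j → H j b)) ≡ ∑ (λ i → ∑ (F i)) + ∑ (λ j → ∑ (H j))
∑-distrib-∑+∑ F H = trans (∑-distrib-+ (λ b → ∑ (λ i → F i b)) (λ b → ∑ (λ j → H j b)))
                          (cong₂ _+_ (sym (∑-comm F)) (sym (∑-comm H)))

tightProduct : (G₁ : Multigraph n₁) (G₂ : Multigraph n₂) →
               Factorisation (adj G₁) d e → Factorisation (adj G₂) d e → HaveTightProduct G₁ G₂
tightProduct {n₁} {n₂} {d} {e} G₁ G₂ F₁ F₂ =
  productGraph K K-sym K-loops , covering₁ K K-sym K-loops G₁ marginal₁ , covering₂ K K-sym K-loops G₂ marginal₂
  where
  module F₁ = Factorisation F₁
  module F₂ = Factorisation F₂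
  forward backward : Fin d → Kernel n₁ n₂
  forward  i = link (F₁.σ i ⟨$⟩ʳ_) (F₂.σ i ⟨$⟩ʳ_)
  backward i = link (F₁.σ i ⟨$⟩ˡ_) (F₂.σ i ⟨$⟩ˡ_)
  matched : Fin e → Kernel n₁ n₂
  matched j = link (F₁.μ j) (F₂.μ j)
  K : Kernel n₁ n₂
  K u v u′ v′ = ∑ (λ i → forward i u v u′ v′ + backward i u v u′ v′) + ∑ (λ j → matched j u v u′ v′)
  forward≡backward : ∀ i u v u′ v′ → forward i u v u′ v′ ≡ backward i u′ v′ u v
  forward≡backward i = link-inverse (F₁.σ i ⟨$⟩ʳ_) (F₁.σ i ⟨$⟩ˡ_) (F₂.σ i ⟨$⟩ʳ_) (F₂.σ i ⟨$⟩ˡ_)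
    (λ _ → inverseʳ (F₁.σ i)) (λ _ → inverseˡ (F₁.σ i))
                                            (λ _ → inverseʳ (F₂.σ i)) (λ _ → inverseˡ (F₂.σ i))
  backward≡forward : ∀ i u v u′ v′ → backward i u v u′ v′ ≡ forward i u′ v′ u v
  backward≡forward i = link-inverse (F₁.σ i ⟨$⟩ˡ_) (F₁.σ i ⟨$⟩ʳ_) (F₂.σ i ⟨$⟩ˡ_) (F₂.σ i ⟨$⟩ʳ_)
    (λ _ → inverseˡ (F₁.σ i)) (λ _ → inverseʳ (F₁.σ i))
                                            (λ _ → inverseˡ (F₂.σ i)) (λ _ → inverseʳ (F₂.σ i))
  K-sym : ∀ u v u′ v′ → K u v u′ v′ ≡ K u′ v′ u v
  K-sym u v u′ v′ = cong₂ _+_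
    (∑-cong (λ i → trans (cong₂ _+_ (forward≡backward i u v u′ v′) (backward≡forward i u v u′ v′))
                         (+-comm (backward i u′ v′ u v) _)))
    (∑-cong (λ j → link-inverse (F₁.μ j) (F₁.μ j) (F₂.μ j) (F₂.μ j) (F₁.μ-involutive j) (F₁.μ-involutive j)
                                        (F₂.μ-involutive j) (F₂.μ-involutive j) u v u′ v′))
  K-loops : ∀ u v → 2 ∣ K u v u v
  K-loops u v = ∣m∣n⇒∣m+n
    (∣-∑ _ (λ i → subst (2 ∣_) (cong (forward i u v u v +_) (forward≡backward i u v u v)) (2∣n+n (forward i u v u v))))
    (∣-∑ _ (λ j → subst (2 ∣_) (sym (cong (_* δ (F₂.μ j v) v) (δ-≢ (F₁.μ-fixpointFree j u)))) (2 ∣0)))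
  marginal₁ : ∀ u v a → ∑ (K u v a) ≡ adj G₁ u a
  marginal₁ u v a = begin
    ∑ (K u v a)
      ≡⟨ ∑-distrib-∑+∑ (λ i b → forward i u v a b + backward i u v a b) (λ j → matched j u v a) ⟩
    ∑ (λ i → ∑ (λ b → forward i u v a b + backward i u v a b)) + ∑ (λ j → ∑ (matched j u v a))
      ≡⟨ cong₂ _+_ (∑-cong (λ i → trans (∑-distrib-+ (forward i u v a) (backward i u v a))
                                        (cong₂ _+_ (∑-link₂ (F₁.σ i ⟨$⟩ʳ_) (F₂.σ i ⟨$⟩ʳ_) u v a)
                                                   (∑-link₂ (F₁.σ i ⟨$⟩ˡ_) (F₂.σ i ⟨$⟩ˡ_) u v a))))
                   (∑-cong (λ j → ∑-link₂ (F₁.μ j) (F₂.μ j) u v a)) ⟩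
    ∑ (λ i → δ (F₁.σ i ⟨$⟩ʳ u) a + δ (F₁.σ i ⟨$⟩ˡ u) a) + ∑ (λ j → δ (F₁.μ j u) a)
      ≡⟨ F₁.adjacency u a ⟨
    adj G₁ u a ∎
    where open ≡-Reasoning
  marginal₂ : ∀ u v b → ∑ (λ a → K u v a b) ≡ adj G₂ v b
  marginal₂ u v b = begin
    ∑ (λ a → K u v a b)
      ≡⟨ ∑-distrib-∑+∑ (λ i a → forward i u v a b + backward i u v a b) (λ j a → matched j u v a b) ⟩
    ∑ (λ i → ∑ (λ a → forward i u v a b + backward i u v a b)) + ∑ (λ j → ∑ (λ a → matched j u v a b))
      ≡⟨ cong₂ _+_ (∑-cong (λ i → trans (∑-distrib-+ (λ a → forward i u v a b) (λ a → backward i u v a b))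
                                        (cong₂ _+_ (∑-link₁ (F₁.σ i ⟨$⟩ʳ_) (F₂.σ i ⟨$⟩ʳ_) u v b)
                                                   (∑-link₁ (F₁.σ i ⟨$⟩ˡ_) (F₂.σ i ⟨$⟩ˡ_) u v b))))
                   (∑-cong (λ j → ∑-link₁ (F₁.μ j) (F₂.μ j) u v b)) ⟩
    ∑ (λ i → δ (F₂.σ i ⟨$⟩ʳ v) b + δ (F₂.σ i ⟨$⟩ˡ v) b) + ∑ (λ j → δ (F₂.μ j v) b)
      ≡⟨ F₂.adjacency v b ⟨
    adj G₂ v b ∎
    where open ≡-Reasoning

proposition3 :
    (∀ (d n₁ n₂ : ℕ) (G₁ : Multigraph n₁) (G₂ : Multigraph n₂) →
       Regular G₁ (2 * d) → Regular G₂ (2 * d) → HaveTightProduct G₁ G₂)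
    ×
    (∀ (d n₁ n₂ : ℕ) (G₁ : Multigraph n₁) (G₂ : Multigraph n₂) →
       Regular G₁ (2 * d + 1) → Regular G₂ (2 * d + 1) →
       PerfectMatching G₁ → PerfectMatching G₂ → HaveTightProduct G₁ G₂)
proposition3 =
    (λ d _ _ G₁ G₂ regular₁ regular₂ →
       tightProduct G₁ G₂ (evenFactorisation d G₁ regular₁) (evenFactorisation d G₂ regular₂))
  , (λ d _ _ G₁ G₂ regular₁ regular₂ matching₁ matching₂ →
       tightProduct G₁ G₂ (oddFactorisation d G₁ regular₁ matching₁) (oddFactorisation d G₂ regular₂ matching₂))
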